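{- Let $k\geq 4$ be an integer. Then $\mathrm{URT}(k)\geq \tfrac{k-1}{k-2}$. Moreover, the longest word over a $k$-letter alphabet that is undirected $\tfrac{k-1}{k-2}$-free has length $k+3$ (i.e., such a word of length $k+3$ exists and none of length $k+4$ exists).
   Context: For a word $x=x_1\cdots x_n$ (letters $x_i$), its reversal is $x^R=x_n\cdots x_1$. For rational $1<r\leq 2$, an undirected $r$-power is a word $xyx'$ with $x$ nonempty, $x'\in\{x,x^R\}$, and $|xyx'|/|xy|=r$. For real $1<\alpha\leq 2$, a word is undirected $\alpha$-free if none of its factors is an undirected $r$-power for any rational $r\geq\alpha$. Undirected $r$-powers are $k$-avoidable if there is an infinite word over a $k$-letter alphabet that is undirected $r$-free, and $\mathrm{URT}(k)=\inf\{r : \text{undirected } r\text{ -powers are } k\text{ -avoidable}\}$.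
   Formalization: The bound on $\mathrm{URT}(k)$ is stated only for rational exponents r in (1,2] at which undirected r-powers are k-avoidable, rather than for real ones. -}

module Defs where

open import Data.Nat using (ℕ; zero; suc; _+_)
open import Data.Integer using (+_)
open import Data.Rational using (ℚ; _/_; _≤_; _<_; 0ℚ)
open import Data.List using (List; _∷_; []; _++_; length; reverse; applyUpTo)
open import Data.Product using (Σ; ∃; _×_; _,_)
open import Data.Sum using (_⊎_)
open import Relation.Binary.PropositionalEquality using (_≡_)
open import Relation.Nullary using (¬_)

-- An undirected r-power: w = x y x' with x nonempty (x = a ∷ x₀),
-- x' ∈ {x, x^R}, and |x y x'| / |x y| = r.
-- Here |x y| = suc (|x₀| + |y|), which is nonzero.
record UPower {A : Set} (r : ℚ) (w : List A) : Set where
  constructor upower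
  field
    a   : A
    x₀  : List A
    y   : List A
    x'  : List A
    x'-ok : x' ≡ (a ∷ x₀) ⊎ x' ≡ reverse (a ∷ x₀)
    w-eq  : w ≡ (a ∷ x₀) ++ y ++ x'
    r-eq  : r ≡ (+ length w) / suc (length x₀ + length y)

Factor : {A : Set} → List A → List A → Set
Factor f w = ∃ λ u → ∃ λ v → w ≡ u ++ f ++ v

UFree : {A : Set} → ℚ → List A → Set
UFree α w = ∀ f → Factor f w → ∀ (r : ℚ) → α ≤ r → ¬ UPower r f

prefix : {A : Set} → (ℕ → A) → ℕ → List A
prefix s n = applyUpTo s n

UFreeInf : {A : Set} → ℚ → (ℕ → A) → Set
UFreeInf α s = ∀ n → UFree α (prefix s n)

UAvoidable : Set → ℚ → Set
UAvoidable A r = Σ (ℕ → A) λ s → UFreeInf r s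

-- the threshold (k-1)/(k-2), meaningful for k ≥ 3: for k = d + 3 it is (d+2)/(d+1).
-- (value for k < 3 is irrelevant; the theorem assumes k ≥ 4)
threshold : ℕ → ℚ
threshold (suc (suc (suc d))) = (+ suc (suc d)) / suc d
threshold _ = 0ℚ

{-# OPTIONS --safe #-}
-- Write n = k − 2, so that an undirected power x y x' reaches the exponent (k−1)/(k−2) exactly
-- when its period |x y| is at most n |x|. With |x| = 1 this makes any n + 1 consecutive letters
-- distinct; with |x| = 2 it forbids two consecutive letters from reappearing, in the same or the
-- opposite order, within distance 2n. For k ≥ 6 these constraints already exclude length k + 4:
-- the first n + 1 letters are distinct, so only one letter is missing from them, and each of the
-- next five letters either repeats one of the first few letters or is that missing letter; a case
-- analysis of these five choices always produces a forbidden short power. For k = 4, 5 a pruned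
-- exhaustive search does the same. A free word of length k + 3 is 0 1 ⋯ n 0 (n+1) 1 3 (for k = 4,
-- 0120310): its only repeated letters are at distance more than n, no two repeats are adjacent and
-- no two have the same midpoint, which rules out every undirected power. Finally, an infinite word
-- avoiding some r < (k−1)/(k−2) would have a (k−1)/(k−2)-free prefix of length k + 4.
module Submission where

open import Defs
open import Data.Nat using (ℕ; _+_) renaming (_≤_ to _≤ℕ_)
open import Data.Fin using (Fin)
open import Data.Rational using (ℚ; 1ℚ; _≤_; _<_; _/_)
open import Data.Integer using (+_)
open import Data.List using (List; length)
open import Data.Product using (_×_; ∃)
open import Relation.Binary.PropositionalEquality using (_≡_)
open import Relation.Nullary using (¬_)

open import Data.Bool using (T)
open import Data.Empty using (⊥; ⊥-elim)
import Data.Fin as Fin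
open import Data.Fin using (toℕ; fromℕ<)
open import Data.Fin.Patterns using (0F; 1F; 2F; 3F; 4F)
import Data.Fin.Properties as Fin
open import Data.Integer as ℤ using (+≤+)
open import Data.Integer.Properties using (pos-*; drop‿+≤+)
open import Data.List using ([]; _∷_; _++_; _ʳ++_; reverse; applyUpTo; take; drop; foldr)
open import Data.List.Properties
  using ( length-++; length-++-≤ˡ; length-applyUpTo; length-reverse; take++drop≡id; ++-assoc
        ; unfold-reverse; reverse-involutive)
open import Data.Maybe as Maybe using (Maybe; nothing; just; _<∣>_; to-witness-T)
open import Data.Nat as ℕ using (zero; suc; _*_; z≤n; s≤s; _≤ᵇ_; _<ᵇ_)
  renaming (_<_ to _<ℕ_; _≤?_ to _≤ℕ?_; _<?_ to _<ℕ?_)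
import Data.Nat.Properties as ℕ
open import Data.Nat.Properties using (anyUpTo?)
open import Data.Nat.DivMod using (_mod_; m<n⇒m%n≡m)
open import Data.Nat.Solver using (module +-*-Solver)
open import Data.Product using (_,_)
open import Data.Rational using (toℚᵘ)
import Data.Rational.Properties as ℚ
open import Data.Rational.Properties using (toℚᵘ-fromℚᵘ; toℚᵘ-mono-≤; toℚᵘ-cancel-≤)
import Data.Rational.Unnormalised as ℚᵘ
import Data.Rational.Unnormalised.Properties as ℚᵘ
open import Data.Sum using (_⊎_; inj₁; inj₂)
open import Function using (_∘_)
open import Relation.Binary.PropositionalEquality
  using (_≢_; refl; sym; trans; cong; cong₂; subst; subst₂; module ≡-Reasoning)
open import Relation.Nullary using (Dec; yes; no)
open import Relation.Nullary.Decidable using (map′; _×-dec_; _⊎-dec_; _→-dec_; dec⇒maybe; from-no)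

private
  toℚᵘ-/ : ∀ a b → toℚᵘ ((+ a) / suc b) ℚᵘ.≃ ℚᵘ.mkℚᵘ (+ a) b
  toℚᵘ-/ a b = toℚᵘ-fromℚᵘ (ℚᵘ.mkℚᵘ (+ a) b)

/≤/⇒*≤* : ∀ a b c e → (+ a) / suc b ≤ (+ c) / suc e → a * suc e ≤ℕ c * suc b
/≤/⇒*≤* a b c e le
  with ℚᵘ.*≤* h ← ℚᵘ.≤-respʳ-≃ (toℚᵘ-/ c e) (ℚᵘ.≤-respˡ-≃ (toℚᵘ-/ a b) (toℚᵘ-mono-≤ le))
  = drop‿+≤+ (subst₂ ℤ._≤_ (sym (pos-* a (suc e))) (sym (pos-* c (suc b))) h)

*≤*⇒/≤/ : ∀ a b c e → a * suc e ≤ℕ c * suc b → (+ a) / suc b ≤ (+ c) / suc e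
*≤*⇒/≤/ a b c e h = toℚᵘ-cancel-≤
  (ℚᵘ.≤-respʳ-≃ (ℚᵘ.≃-sym (toℚᵘ-/ c e)) (ℚᵘ.≤-respˡ-≃ (ℚᵘ.≃-sym (toℚᵘ-/ a b))
    (ℚᵘ.*≤* (subst₂ ℤ._≤_ (pos-* a (suc e)) (pos-* c (suc b)) (+≤+ h)))))

-- With P = suc p and C = suc c, the cross-multiplied inequality (1 + C) P ≤ (P + m) C
-- is P + C P ≤ m C + C P.
private
  [P+m]*C≡m*C+C*P : ∀ P m C → (P + m) * C ≡ m * C + C * P
  [P+m]*C≡m*C+C*P = solve 3 (λ P m C → (P :+ m) :* C := m :* C :+ C :* P) refl
    where open +-*-Solver

threshold≤⇒period≤ : ∀ c p m → threshold (3 + c) ≤ (+ (suc p + m)) / suc p → suc p ≤ℕ m * suc c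
threshold≤⇒period≤ c p m le = ℕ.+-cancelʳ-≤ (suc c * suc p) (suc p) (m * suc c)
  (ℕ.≤-trans (/≤/⇒*≤* (2 + c) c (suc p + m) p le) (ℕ.≤-reflexive ([P+m]*C≡m*C+C*P (suc p) m (suc c))))

period≤⇒threshold≤ : ∀ c p m → suc p ≤ℕ m * suc c → threshold (3 + c) ≤ (+ (suc p + m)) / suc p
period≤⇒threshold≤ c p m le = *≤*⇒/≤/ (2 + c) c (suc p + m) p
  (ℕ.≤-trans (ℕ.+-monoˡ-≤ (suc c * suc p) le) (ℕ.≤-reflexive (sym ([P+m]*C≡m*C+C*P (suc p) m (suc c)))))

UFree-mono : ∀ {A : Set} {α β} {w : List A} → α ≤ β → UFree α w → UFree β w
UFree-mono α≤β free f fac r β≤r = free f fac r (ℚ.≤-trans α≤β β≤r)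

-- Positions past the end of the word read the letter zero.
_!_ : ∀ {m} → List (Fin (suc m)) → ℕ → Fin (suc m)
[]      ! _     = Fin.zero
(a ∷ w) ! zero  = a
(a ∷ w) ! suc i = w ! i

!-++ʳ : ∀ {k} (u : List (Fin (suc k))) {v} i → (u ++ v) ! (length u + i) ≡ v ! i
!-++ʳ []      i = refl
!-++ʳ (a ∷ u) i = !-++ʳ u i

!-++ˡ : ∀ {k} (u : List (Fin (suc k))) v {i} → i <ℕ length u → (u ++ v) ! i ≡ u ! i
!-++ˡ (a ∷ u) v {zero}  _       = refl
!-++ˡ (a ∷ u) v {suc i} (s≤s h) = !-++ˡ u v h

!-infix : ∀ {k} (u f v : List (Fin (suc k))) {i l} → i ≡ length u + l → l <ℕ length f → (u ++ f ++ v) ! i ≡ f ! l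
!-infix u f v {l = l} refl l<∣f∣ = trans (!-++ʳ u l) (!-++ˡ f v l<∣f∣)

!-++-++ʳ : ∀ {k} (x y x' : List (Fin (suc k))) l → (x ++ y ++ x') ! (length x + length y + l) ≡ x' ! l
!-++-++ʳ x y x' l = begin
  (x ++ y ++ x') ! (length x + length y + l)     ≡⟨ cong (_! (length x + length y + l)) (sym (++-assoc x y x')) ⟩
  ((x ++ y) ++ x') ! (length x + length y + l)   ≡⟨ cong (λ i → ((x ++ y) ++ x') ! (i + l)) (sym (length-++ x)) ⟩
  ((x ++ y) ++ x') ! (length (x ++ y) + l)       ≡⟨ !-++ʳ (x ++ y) l ⟩
  x' ! l                                         ∎
  where open ≡-Reasoning

!-applyUpTo : ∀ {k} (f : ℕ → Fin (suc k)) {m i} → i <ℕ m → applyUpTo f m ! i ≡ f i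
!-applyUpTo f {suc m} {zero}  _         = refl
!-applyUpTo f {suc m} {suc i} (s≤s i<m) = !-applyUpTo (f ∘ suc) i<m

reverse-!-last : ∀ {k} (a : Fin (suc k)) x₀ → reverse (a ∷ x₀) ! length x₀ ≡ a
reverse-!-last a x₀ = trans (cong (_! length x₀) (unfold-reverse a x₀))
  (!-infix (reverse x₀) (a ∷ []) [] (sym (trans (ℕ.+-identityʳ _) (length-reverse x₀))) (s≤s z≤n))

reverse-!-head : ∀ {k} (a : Fin (suc k)) x₀ → reverse (a ∷ x₀) ! 0 ≡ (a ∷ x₀) ! length x₀
reverse-!-head a []       = refl
reverse-!-head a (b ∷ x₁) = begin
  reverse (a ∷ b ∷ x₁) ! 0              ≡⟨ cong (_! 0) (unfold-reverse a (b ∷ x₁)) ⟩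
  (reverse (b ∷ x₁) ++ a ∷ []) ! 0      ≡⟨ !-++ˡ (reverse (b ∷ x₁)) (a ∷ []) 0<∣b∷x₁ʳ∣ ⟩
  reverse (b ∷ x₁) ! 0                  ≡⟨ reverse-!-head b x₁ ⟩
  (b ∷ x₁) ! length x₁                  ∎
  where
  open ≡-Reasoning
  0<∣b∷x₁ʳ∣ : 0 <ℕ length (reverse (b ∷ x₁))
  0<∣b∷x₁ʳ∣ = subst (0 <ℕ_) (sym (length-reverse (b ∷ x₁))) (s≤s z≤n)

length-infix : ∀ {A : Set} (u f v : List A) → length u + length f ≤ℕ length (u ++ f ++ v)
length-infix u f v = begin
  length u + length f                ≤⟨ ℕ.+-monoʳ-≤ (length u) (ℕ.m≤m+n (length f) (length v)) ⟩
  length u + (length f + length v)   ≡⟨ cong (λ l → length u + l) (sym (length-++ f)) ⟩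
  length u + length (f ++ v)         ≡⟨ sym (length-++ u) ⟩
  length (u ++ f ++ v)               ∎
  where open ℕ.≤-Reasoning

window : ∀ {k} → List (Fin (suc k)) → ℕ → ℕ → List (Fin (suc k))
window w i n = applyUpTo (λ l → w ! (i + l)) n

applyUpTo-cong : ∀ {A : Set} {f g : ℕ → A} → (∀ l → f l ≡ g l) → ∀ n → applyUpTo f n ≡ applyUpTo g n
applyUpTo-cong f≗g zero    = refl
applyUpTo-cong f≗g (suc n) = cong₂ _∷_ (f≗g 0) (applyUpTo-cong (f≗g ∘ suc) n)

applyUpTo-++ : ∀ {A : Set} (f : ℕ → A) m n → applyUpTo f (m + n) ≡ applyUpTo f m ++ applyUpTo (λ l → f (m + l)) n
applyUpTo-++ f zero    n = refl
applyUpTo-++ f (suc m) n = cong (f 0 ∷_) (applyUpTo-++ (f ∘ suc) m n)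

length-window : ∀ {k} (w : List (Fin (suc k))) i n → length (window w i n) ≡ n
length-window w i n = length-applyUpTo (λ l → w ! (i + l)) n

window-++ : ∀ {k} (w : List (Fin (suc k))) i m n → window w i (m + n) ≡ window w i m ++ window w (i + m) n
window-++ w i m n = trans (applyUpTo-++ _ m n)
  (cong (window w i m ++_) (applyUpTo-cong (λ l → cong (w !_) (sym (ℕ.+-assoc i m l))) n))

applyUpTo-! : ∀ {k} n (w : List (Fin (suc k))) → n ≤ℕ length w → applyUpTo (w !_) n ≡ take n w
applyUpTo-! zero    w       _        = refl
applyUpTo-! (suc n) (a ∷ w) (s≤s le) = cong (a ∷_) (applyUpTo-! n w le)

window-factor : ∀ {k} (w : List (Fin (suc k))) i n → i + n ≤ℕ length w → Factor (window w i n) w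
window-factor w zero n le =
  [] , drop n w , sym (trans (cong (_++ drop n w) (applyUpTo-! n w le)) (take++drop≡id n w))
window-factor (a ∷ w) (suc i) n (s≤s le) with u , v , eq ← window-factor w i n le = a ∷ u , v , cong (a ∷_) eq

window-at : ∀ {k} (w : List (Fin (suc k))) {i j} n → i ≡ j → window w i n ≡ window w j n
window-at w n refl = refl

window-one : ∀ {k} (w : List (Fin (suc k))) i → window w i 1 ≡ w ! i ∷ []
window-one w i = cong (λ l → w ! l ∷ []) (ℕ.+-identityʳ i)

window-two : ∀ {k} (w : List (Fin (suc k))) i → window w i 2 ≡ w ! i ∷ w ! suc i ∷ []
window-two w i = cong₂ (λ l l' → w ! l ∷ w ! l' ∷ []) (ℕ.+-identityʳ i) (ℕ.+-comm i 1)

Echo : ∀ {A : Set} → List A → List A → Set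
Echo x x' = x' ≡ x ⊎ x' ≡ reverse x

length-echo : ∀ {A : Set} {x x' : List A} → Echo x x' → length x' ≡ length x
length-echo (inj₁ refl) = refl
length-echo {x = x} (inj₂ refl) = length-reverse x

length-power : ∀ {A : Set} (x y : List A) {x'} → Echo x x' →
  length (x ++ y ++ x') ≡ length x + length y + length x
length-power x y {x'} echo = begin
  length (x ++ y ++ x')                ≡⟨ length-++ x ⟩
  length x + length (y ++ x')          ≡⟨ cong (λ l → length x + l) (length-++ y) ⟩
  length x + (length y + length x')    ≡⟨ sym (ℕ.+-assoc (length x) (length y) _) ⟩
  length x + length y + length x'      ≡⟨ cong (λ l → length x + length y + l) (length-echo echo) ⟩
  length x + length y + length x       ∎
  where open ≡-Reasoning

power⇒¬free : ∀ c {A : Set} {w u x y x' v : List A} → w ≡ u ++ (x ++ y ++ x') ++ v →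
  Echo x x' → 0 <ℕ length x → length x + length y ≤ℕ length x * suc c →
  ¬ UFree (threshold (3 + c)) w
power⇒¬free c {x = a ∷ x₀} {y} {x'} eq echo _ short free =
  free _ (_ , _ , eq) _ threshold≤exponent (upower a x₀ y x' echo refl refl)
  where
  threshold≤exponent : threshold (3 + c) ≤ (+ length ((a ∷ x₀) ++ y ++ x')) / suc (length x₀ + length y)
  threshold≤exponent = subst (λ L → threshold (3 + c) ≤ (+ L) / suc (length x₀ + length y))
    (sym (length-power (a ∷ x₀) y echo)) (period≤⇒threshold≤ c (length x₀ + length y) (suc (length x₀)) short)

window-power⇒¬free : ∀ c {k} (w : List (Fin (suc k))) i m q →
  i + (suc m + q + suc m) ≤ℕ length w → suc (m + q) ≤ℕ suc m * suc c →
  Echo (window w i (suc m)) (window w (i + (suc m + q)) (suc m)) →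
  ¬ UFree (threshold (3 + c)) w
window-power⇒¬free c w i m q fits short echo with u , v , eq ← window-factor w i _ fits =
  power⇒¬free c (subst (λ f → w ≡ u ++ f ++ v) split eq) echo (s≤s z≤n)
    (subst₂ (λ a b → a + b ≤ℕ a * suc c) (sym (length-window w i (suc m))) (sym (length-window w (i + suc m) q)) short)
  where
  x  = window w i (suc m)
  y  = window w (i + suc m) q
  x' = window w (i + (suc m + q)) (suc m)
  split : window w i (suc m + q + suc m) ≡ x ++ y ++ x'
  split = begin
    window w i (suc m + q + suc m)           ≡⟨ window-++ w i (suc m + q) (suc m) ⟩
    window w i (suc m + q) ++ x'             ≡⟨ cong (_++ x') (window-++ w i (suc m) q) ⟩
    (x ++ y) ++ x'                           ≡⟨ ++-assoc x y x' ⟩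
    x ++ y ++ x'                             ∎
    where open ≡-Reasoning

-- The undirected powers with |x| ≤ 2 that (n+1)/n-freeness forbids, in terms of positions.
record NoShortPowers {k} (n : ℕ) (w : List (Fin (suc k))) : Set where
  field
    distinct  : ∀ i j → i <ℕ j → j <ℕ length w → j ≤ℕ i + n → w ! i ≢ w ! j
    no-copy   : ∀ i j → 2 + i ≤ℕ j → suc j <ℕ length w → j ≤ℕ i + (n + n) →
                w ! i ≡ w ! j → w ! suc i ≢ w ! suc j
    no-mirror : ∀ i j → 2 + i ≤ℕ j → suc j <ℕ length w → j ≤ℕ i + (n + n) →
                w ! i ≡ w ! suc j → w ! suc i ≢ w ! j

module _ (c : ℕ) {k : ℕ} (w : List (Fin (suc k))) (free : UFree (threshold (3 + c)) w) where
  open +-*-Solver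

  free⇒distinct : ∀ i j → i <ℕ j → j <ℕ length w → j ≤ℕ i + suc c → w ! i ≢ w ! j
  free⇒distinct i j i<j j<∣w∣ j≤ eq with q , refl ← ℕ.m≤n⇒∃[o]m+o≡n i<j =
    window-power⇒¬free c w i 0 q fits short (inj₁ echo) free
    where
    fits : i + (1 + q + 1) ≤ℕ length w
    fits = subst (_≤ℕ length w) (solve 2 (λ i q → con 2 :+ i :+ q := i :+ (con 1 :+ q :+ con 1)) refl i q) j<∣w∣
    short : suc q ≤ℕ 1 * suc c
    short = subst (suc q ≤ℕ_) (sym (ℕ.*-identityˡ (suc c)))
      (ℕ.+-cancelˡ-≤ i (suc q) (suc c) (subst (_≤ℕ i + suc c) (sym (ℕ.+-suc i q)) j≤))
    echo : window w (i + (1 + q)) 1 ≡ window w i 1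
    echo = begin
      window w (i + (1 + q)) 1 ≡⟨ window-at w 1 (ℕ.+-suc i q) ⟩
      window w (suc i + q) 1   ≡⟨ window-one w (suc i + q) ⟩
      w ! (suc i + q) ∷ []     ≡⟨ cong (_∷ []) (sym eq) ⟩
      w ! i ∷ []               ≡⟨ sym (window-one w i) ⟩
      window w i 1             ∎
      where open ≡-Reasoning

  free⇒no-pair-echo : ∀ i j → 2 + i ≤ℕ j → suc j <ℕ length w → j ≤ℕ i + (suc c + suc c) →
    ¬ Echo (w ! i ∷ w ! suc i ∷ []) (w ! j ∷ w ! suc j ∷ [])
  free⇒no-pair-echo i j 2+i≤j j<∣w∣ j≤ echo with q , refl ← ℕ.m≤n⇒∃[o]m+o≡n 2+i≤j =
    window-power⇒¬free c w i 1 q fits short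
      (subst₂ Echo (sym (window-two w i)) (sym x'-window) echo) free
    where
    fits : i + (2 + q + 2) ≤ℕ length w
    fits = subst (_≤ℕ length w) (solve 2 (λ i q → con 4 :+ i :+ q := i :+ (con 2 :+ q :+ con 2)) refl i q) j<∣w∣
    short : 2 + q ≤ℕ 2 * suc c
    short = subst (2 + q ≤ℕ_) (solve 1 (λ c → (con 1 :+ c) :+ (con 1 :+ c) := con 2 :* (con 1 :+ c)) refl c)
      (ℕ.+-cancelˡ-≤ i (2 + q) (suc c + suc c)
        (subst (_≤ℕ i + (suc c + suc c)) (solve 2 (λ i q → con 2 :+ i :+ q := i :+ (con 2 :+ q)) refl i q) j≤))
    x'-window : window w (i + (2 + q)) 2 ≡ w ! (2 + i + q) ∷ w ! suc (2 + i + q) ∷ []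
    x'-window = trans (window-at w 2 (solve 2 (λ i q → i :+ (con 2 :+ q) := con 2 :+ i :+ q) refl i q))
      (window-two w (2 + i + q))

  free⇒noShortPowers : NoShortPowers (suc c) w
  free⇒noShortPowers = record
    { distinct  = free⇒distinct
    ; no-copy   = λ i j 2+i≤j j<∣w∣ j≤ e₀ e₁ →
        free⇒no-pair-echo i j 2+i≤j j<∣w∣ j≤ (inj₁ (cong₂ (λ a b → a ∷ b ∷ []) (sym e₀) (sym e₁)))
    ; no-mirror = λ i j 2+i≤j j<∣w∣ j≤ e₀ e₁ →
        free⇒no-pair-echo i j 2+i≤j j<∣w∣ j≤ (inj₂ (cong₂ (λ a b → a ∷ b ∷ []) (sym e₁) (sym e₀)))
    }

NoShortPowers-∷⁻ : ∀ {k n} {a : Fin (suc k)} {w} → NoShortPowers n (a ∷ w) → NoShortPowers n w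
NoShortPowers-∷⁻ h = record
  { distinct  = λ i j i<j j<∣w∣ j≤ → distinct (suc i) (suc j) (s≤s i<j) (s≤s j<∣w∣) (s≤s j≤)
  ; no-copy   = λ i j 2+i≤j j<∣w∣ j≤ → no-copy (suc i) (suc j) (s≤s 2+i≤j) (s≤s j<∣w∣) (s≤s j≤)
  ; no-mirror = λ i j 2+i≤j j<∣w∣ j≤ → no-mirror (suc i) (suc j) (s≤s 2+i≤j) (s≤s j<∣w∣) (s≤s j≤)
  }
  where open NoShortPowers h

NoShortPowers-ʳ++⁻ : ∀ {k n} (v : List (Fin (suc k))) {w} → NoShortPowers n (v ʳ++ w) → NoShortPowers n w
NoShortPowers-ʳ++⁻ []      h = h
NoShortPowers-ʳ++⁻ (a ∷ v) h = NoShortPowers-∷⁻ (NoShortPowers-ʳ++⁻ v h)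

allFin : ∀ {m} {P : Fin m → Set} → ((a : Fin m) → Maybe (P a)) → Maybe ((a : Fin m) → P a)
allFin {zero}  f = just (λ ())
allFin {suc m} f with f Fin.zero | allFin (λ a → f (Fin.suc a))
... | just p | just ps = just λ { Fin.zero → p ; (Fin.suc a) → ps a }
... | _      | _       = nothing

-- Backtracking search: letters are prepended one at a time, and a branch is cut as soon as its
-- first letter violates a constraint.
module _ {k : ℕ} (n : ℕ) where
  open NoShortPowers

  headViolationAt : ∀ (w : List (Fin (suc k))) → ℕ → Maybe (¬ NoShortPowers n w)
  headViolationAt w j =
        Maybe.map (λ (1≤j , j<∣w∣ , j≤n , e) h → distinct h 0 j 1≤j j<∣w∣ j≤n e)
          (dec⇒maybe (1 ≤ℕ? j ×-dec j <ℕ? length w ×-dec j ≤ℕ? n ×-dec w ! 0 Fin.≟ w ! j))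
    <∣> Maybe.map (λ (2≤j , j<∣w∣ , j≤2n , e , e') h → no-copy h 0 j 2≤j j<∣w∣ j≤2n e e')
          (dec⇒maybe (2 ≤ℕ? j ×-dec suc j <ℕ? length w ×-dec j ≤ℕ? n + n ×-dec
                      w ! 0 Fin.≟ w ! j ×-dec w ! 1 Fin.≟ w ! suc j))
    <∣> Maybe.map (λ (2≤j , j<∣w∣ , j≤2n , e , e') h → no-mirror h 0 j 2≤j j<∣w∣ j≤2n e e')
          (dec⇒maybe (2 ≤ℕ? j ×-dec suc j <ℕ? length w ×-dec j ≤ℕ? n + n ×-dec
                      w ! 0 Fin.≟ w ! suc j ×-dec w ! 1 Fin.≟ w ! j))

  headViolation : ∀ (w : List (Fin (suc k))) → Maybe (¬ NoShortPowers n w)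
  headViolation w = foldr _<∣>_ nothing (applyUpTo (headViolationAt w) (length w))

  Refuted : ℕ → List (Fin (suc k)) → Set
  Refuted m w = ∀ v → length v ≡ m → ¬ NoShortPowers n (v ʳ++ w)

  refute : ∀ m w → Maybe (Refuted m w)
  extend : ∀ m w → Maybe (Refuted m w)

  refute m w = Maybe.map (λ ¬h v _ h → ¬h (NoShortPowers-ʳ++⁻ v h)) (headViolation w) <∣> extend m w

  extend zero    w = nothing
  extend (suc m) w =
    Maybe.map (λ H → λ { (a ∷ v) len → H a v (ℕ.suc-injective len) }) (allFin (λ a → refute m (a ∷ w)))

  refuted⇒¬NoShortPowers : ∀ {m} → Refuted m [] → ∀ w → length w ≡ m → ¬ NoShortPowers n w
  refuted⇒¬NoShortPowers H w len h =
    H (reverse w) (trans (length-reverse w) len) (subst (NoShortPowers n) (sym (reverse-involutive w)) h)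

¬NoShortPowers-n=2 : ∀ (w : List (Fin 4)) → length w ≡ 8 → ¬ NoShortPowers 2 w
¬NoShortPowers-n=2 = refuted⇒¬NoShortPowers 2 (to-witness-T (refute 2 8 []) _)

¬NoShortPowers-n=3 : ∀ (w : List (Fin 5)) → length w ≡ 9 → ¬ NoShortPowers 3 w
¬NoShortPowers-n=3 = refuted⇒¬NoShortPowers 3 (to-witness-T (refute 3 9 []) _)

-- Positions 0 … n carry n + 1 distinct letters, so exactly one letter of the alphabet is missing
-- there. The letter at pos t = n + 1 + t is not at positions t + 1 … n (they are too close), so
-- it is copied from a position i ≤ t or it is the missing letter.
module _ (n : ℕ) (4≤n : 4 ≤ℕ n) (w : List (Fin (2 + n))) (len : length w ≡ 2 + n + 4) (h : NoShortPowers n w) where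
  open NoShortPowers h

  pos : ℕ → ℕ
  pos t = suc t + n

  Fresh : ℕ → Set
  Fresh t = ∀ i → i ≤ℕ n → w ! pos t ≢ w ! i

  data Source (t : ℕ) : Set where
    copied : (i : Fin (suc t)) → w ! pos t ≡ w ! toℕ i → Source t
    fresh  : Fresh t → Source t

  private
    1≤n : 1 ≤ℕ n
    1≤n = ℕ.≤-trans (s≤s z≤n) 4≤n

    pos<∣w∣ : ∀ {t} → t ≤ℕ 4 → pos t <ℕ length w
    pos<∣w∣ {t} t≤4 =
      subst (pos t <ℕ_) (sym len) (s≤s (s≤s (subst (_≤ℕ n + 4) (ℕ.+-comm n t) (ℕ.+-monoʳ-≤ n t≤4))))

    pos-near : ∀ {t t'} → t' ≤ℕ 4 → pos t' ≤ℕ pos t + n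
    pos-near {t} t'≤4 = ℕ.+-monoˡ-≤ n (s≤s (ℕ.≤-trans (ℕ.≤-trans t'≤4 4≤n) (ℕ.m≤n+m n t)))

  source : ∀ t {_ : T (t ≤ᵇ 4)} → Source t
  source t {t≤4} with Fin.any? (λ (i : Fin (suc t)) → w ! pos t Fin.≟ w ! toℕ i)
  ... | yes (i , e) = copied i e
  ... | no ¬copied = fresh not-earlier
    where
    not-earlier : Fresh t
    not-earlier i i≤n e with i ≤ℕ? t
    ... | yes i≤t =
      ¬copied (fromℕ< (s≤s i≤t) , subst (λ l → w ! pos t ≡ w ! l) (sym (Fin.toℕ-fromℕ< (s≤s i≤t))) e)
    ... | no  i≰t = distinct i (pos t) (s≤s (ℕ.≤-trans i≤n (ℕ.m≤n+m n t))) (pos<∣w∣ (ℕ.≤ᵇ⇒≤ t 4 t≤4))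
                      (ℕ.+-monoˡ-≤ n (ℕ.≰⇒> i≰t)) (sym e)

  pos-distinct : ∀ {t t'} → t <ℕ t' → t' ≤ℕ 4 → w ! pos t ≢ w ! pos t'
  pos-distinct t<t' t'≤4 = distinct _ _ (ℕ.+-monoˡ-< n (s≤s t<t')) (pos<∣w∣ t'≤4) (pos-near t'≤4)

  same-source : ∀ t t' {i} {_ : T (t <ᵇ t')} {_ : T (t' ≤ᵇ 4)} → w ! pos t ≡ w ! i → w ! pos t' ≡ w ! i → ⊥
  same-source t t' {_} {t<t'} {t'≤4} e e' =
    pos-distinct (ℕ.<ᵇ⇒< t t' t<t') (ℕ.≤ᵇ⇒≤ t' 4 t'≤4) (trans e (sym e'))

  two-fresh : ∀ t t' {_ : T (t <ᵇ t')} {_ : T (t' ≤ᵇ 4)} → Fresh t → Fresh t' → ⊥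
  two-fresh t t' {t<t'} {t'≤4} φ φ' with Fin.pigeonhole (ℕ.n<1+n (2 + n)) letters
    where
    letters : Fin (3 + n) → Fin (2 + n)
    letters Fin.zero             = w ! pos t
    letters (Fin.suc Fin.zero)    = w ! pos t'
    letters (Fin.suc (Fin.suc i)) = w ! toℕ i
  ... | Fin.zero , Fin.suc Fin.zero , _ , e =
    pos-distinct (ℕ.<ᵇ⇒< t t' t<t') (ℕ.≤ᵇ⇒≤ t' 4 t'≤4) e
  ... | Fin.zero , Fin.suc (Fin.suc j) , _ , e = φ (toℕ j) (Fin.toℕ≤pred[n] j) e
  ... | Fin.suc Fin.zero , Fin.suc Fin.zero , s≤s () , _
  ... | Fin.suc Fin.zero , Fin.suc (Fin.suc j) , _ , e = φ' (toℕ j) (Fin.toℕ≤pred[n] j) e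
  ... | Fin.suc (Fin.suc i) , Fin.suc (Fin.suc j) , s≤s (s≤s i<j) , e =
    distinct (toℕ i) (toℕ j) i<j
      (subst (toℕ j <ℕ_) (sym len) (ℕ.<-≤-trans (Fin.toℕ<n j) (ℕ.m≤n⇒m≤1+n (s≤s (ℕ.m≤m+n n 4)))))
      (ℕ.≤-trans (Fin.toℕ≤pred[n] j) (ℕ.m≤n+m n (toℕ i))) e

  private
    2+i≤pos : ∀ {i t} → i ≤ℕ t → 2 + i ≤ℕ pos t
    2+i≤pos {i} {t} i≤t = s≤s (subst (_≤ℕ t + n) (ℕ.+-comm i 1) (ℕ.+-mono-≤ i≤t 1≤n))

    pos≤i+2n : ∀ {t} i → t ≤ℕ 3 → pos t ≤ℕ i + (n + n)
    pos≤i+2n i t≤3 = ℕ.≤-trans (ℕ.+-monoˡ-≤ n (ℕ.≤-trans (s≤s t≤3) 4≤n)) (ℕ.m≤n+m (n + n) i)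

  rising-sources : ∀ t i {_ : T (t ≤ᵇ 3)} {_ : T (i ≤ᵇ t)} →
    w ! pos t ≡ w ! i → w ! pos (suc t) ≡ w ! suc i → ⊥
  rising-sources t i {t≤3} {i≤t} e e' =
    no-copy i (pos t) (2+i≤pos (ℕ.≤ᵇ⇒≤ i t i≤t)) (pos<∣w∣ (s≤s (ℕ.≤ᵇ⇒≤ t 3 t≤3)))
      (pos≤i+2n i (ℕ.≤ᵇ⇒≤ t 3 t≤3)) (sym e) (sym e')

  falling-sources : ∀ t i {_ : T (t ≤ᵇ 3)} {_ : T (i ≤ᵇ t)} →
    w ! pos t ≡ w ! suc i → w ! pos (suc t) ≡ w ! i → ⊥
  falling-sources t i {t≤3} {i≤t} e e' =
    no-mirror i (pos t) (2+i≤pos (ℕ.≤ᵇ⇒≤ i t i≤t)) (pos<∣w∣ (s≤s (ℕ.≤ᵇ⇒≤ t 3 t≤3)))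
      (pos≤i+2n i (ℕ.≤ᵇ⇒≤ t 3 t≤3)) (sym e') (sym e)

  sources-clash : Source 0 → Source 1 → Source 2 → Source 3 → Source 4 → ⊥
  sources-clash (copied 0F e₀) (copied 0F e₁) _              _              _              = same-source 0 1 e₀ e₁
  sources-clash (copied 0F e₀) (copied 1F e₁) _              _              _              = rising-sources 0 0 e₀ e₁
  sources-clash (copied 0F e₀) (fresh _)      (copied 0F e₂) _              _              = same-source 0 2 e₀ e₂
  sources-clash (copied 0F e₀) (fresh _)      (copied 1F _)  (copied 0F e₃) _              = same-source 0 3 e₀ e₃
  sources-clash (copied 0F _)  (fresh _)      (copied 1F e₂) (copied 1F e₃) _              = same-source 2 3 e₂ e₃
  sources-clash (copied 0F _)  (fresh _)      (copied 1F e₂) (copied 2F e₃) _              = rising-sources 2 1 e₂ e₃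
  sources-clash (copied 0F e₀) (fresh _)      (copied 1F _)  (copied 3F _)  (copied 0F e₄) = same-source 0 4 e₀ e₄
  sources-clash (copied 0F _)  (fresh _)      (copied 1F e₂) (copied 3F _)  (copied 1F e₄) = same-source 2 4 e₂ e₄
  sources-clash (copied 0F _)  (fresh _)      (copied 1F _)  (copied 3F e₃) (copied 2F e₄) = falling-sources 3 2 e₃ e₄
  sources-clash (copied 0F _)  (fresh _)      (copied 1F _)  (copied 3F e₃) (copied 3F e₄) = same-source 3 4 e₃ e₄
  sources-clash (copied 0F _)  (fresh _)      (copied 1F _)  (copied 3F e₃) (copied 4F e₄) = rising-sources 3 3 e₃ e₄
  sources-clash (copied 0F _)  (fresh φ₁)     (copied 1F _)  (copied 3F _)  (fresh φ₄)     = two-fresh 1 4 φ₁ φ₄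
  sources-clash (copied 0F _)  (fresh φ₁)     (copied 1F _)  (fresh φ₃)     _              = two-fresh 1 3 φ₁ φ₃
  sources-clash (copied 0F e₀) (fresh _)      (copied 2F _)  (copied 0F e₃) _              = same-source 0 3 e₀ e₃
  sources-clash (copied 0F _)  (fresh _)      (copied 2F e₂) (copied 1F e₃) _              = falling-sources 2 1 e₂ e₃
  sources-clash (copied 0F _)  (fresh _)      (copied 2F e₂) (copied 2F e₃) _              = same-source 2 3 e₂ e₃
  sources-clash (copied 0F _)  (fresh _)      (copied 2F e₂) (copied 3F e₃) _              = rising-sources 2 2 e₂ e₃
  sources-clash (copied 0F _)  (fresh φ₁)     (copied 2F _)  (fresh φ₃)     _              = two-fresh 1 3 φ₁ φ₃
  sources-clash (copied 0F _)  (fresh φ₁)     (fresh φ₂)     _              _              = two-fresh 1 2 φ₁ φ₂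
  sources-clash (fresh _)      (copied 0F e₁) (copied 0F e₂) _              _              = same-source 1 2 e₁ e₂
  sources-clash (fresh _)      (copied 0F e₁) (copied 1F e₂) _              _              = rising-sources 1 0 e₁ e₂
  sources-clash (fresh _)      (copied 0F e₁) (copied 2F _)  (copied 0F e₃) _              = same-source 1 3 e₁ e₃
  sources-clash (fresh _)      (copied 0F _)  (copied 2F e₂) (copied 1F e₃) _              = falling-sources 2 1 e₂ e₃
  sources-clash (fresh _)      (copied 0F _)  (copied 2F e₂) (copied 2F e₃) _              = same-source 2 3 e₂ e₃
  sources-clash (fresh _)      (copied 0F _)  (copied 2F e₂) (copied 3F e₃) _              = rising-sources 2 2 e₂ e₃
  sources-clash (fresh φ₀)     (copied 0F _)  (copied 2F _)  (fresh φ₃)     _              = two-fresh 0 3 φ₀ φ₃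
  sources-clash (fresh φ₀)     (copied 0F _)  (fresh φ₂)     _              _              = two-fresh 0 2 φ₀ φ₂
  sources-clash (fresh _)      (copied 1F e₁) (copied 0F e₂) _              _              = falling-sources 1 0 e₁ e₂
  sources-clash (fresh _)      (copied 1F e₁) (copied 1F e₂) _              _              = same-source 1 2 e₁ e₂
  sources-clash (fresh _)      (copied 1F e₁) (copied 2F e₂) _              _              = rising-sources 1 1 e₁ e₂
  sources-clash (fresh φ₀)     (copied 1F _)  (fresh φ₂)     _              _              = two-fresh 0 2 φ₀ φ₂
  sources-clash (fresh φ₀)     (fresh φ₁)     _              _              _              = two-fresh 0 1 φ₀ φ₁

  ¬NoShortPowers-4≤n : ⊥
  ¬NoShortPowers-4≤n = sources-clash (source 0) (source 1) (source 2) (source 3) (source 4)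

Copy Mirror : ∀ {k} → List (Fin (suc k)) → (s p m : ℕ) → Set
Copy   w s p m = w ! s ≡ w ! (s + p) × (0 <ℕ m → w ! suc s ≡ w ! (suc s + p))
Mirror w s p m = w ! s ≡ w ! (s + p + m) × w ! (s + m) ≡ w ! (s + p)

-- An undirected power x y x' at position s of w with |x| = suc m, |y| = q and period p = |x y|,
-- seen only through the letter coincidences Copy and Mirror that it forces.
record PowerTraceAt {k} (n : ℕ) (w : List (Fin (suc k))) (s m q : ℕ) : Set where
  constructor powerTraceAt
  p : ℕ
  p = suc (m + q)
  field
    fits  : s + p + suc m ≤ℕ length w
    short : p ≤ℕ suc m * n
    echo  : Copy w s p m ⊎ Mirror w s p m

PowerTrace : ∀ {k} → ℕ → List (Fin (suc k)) → Set
PowerTrace n w = ∃ λ s → ∃ λ m → ∃ λ q → PowerTraceAt n w s m q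

upower⇒trace : ∀ c {k} {w f : List (Fin (suc k))} {r} →
  Factor f w → threshold (3 + c) ≤ r → UPower r f → PowerTrace (suc c) w
upower⇒trace c (u , v , refl) t≤r (upower a x₀ y x' echo refl refl) =
  s , m , q , powerTraceAt fits short (trace-echo echo)
  where
  x = a ∷ x₀
  f = x ++ y ++ x'
  s = length u
  m = length x₀
  q = length y
  p = suc (m + q)
  ∣f∣ : length f ≡ p + suc m
  ∣f∣ = length-power x y echo
  fits : s + p + suc m ≤ℕ length (u ++ f ++ v)
  fits = subst (_≤ℕ length (u ++ f ++ v)) (trans (cong (λ l → s + l) ∣f∣) (sym (ℕ.+-assoc s p (suc m))))
    (length-infix u f v)
  short : p ≤ℕ suc m * suc c
  short = threshold≤⇒period≤ c (m + q) (suc m) (subst (λ L → threshold (3 + c) ≤ (+ L) / p) ∣f∣ t≤r)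
  in-x : ∀ {i} l → l ≤ℕ m → i ≡ s + l → (u ++ f ++ v) ! i ≡ x ! l
  in-x l l≤m i≡ =
    trans (!-infix u f v i≡ (ℕ.<-≤-trans (s≤s l≤m) (length-++-≤ˡ x))) (!-++ˡ x (y ++ x') (s≤s l≤m))
  in-x' : ∀ {i} l → l ≤ℕ m → i ≡ s + p + l → (u ++ f ++ v) ! i ≡ x' ! l
  in-x' l l≤m i≡ = trans (!-infix u f v (trans i≡ (ℕ.+-assoc s p l))
      (subst (p + l <ℕ_) (sym ∣f∣) (ℕ.+-monoʳ-< p (s≤s l≤m))))
    (!-++-++ʳ x y x' l)
  trace-echo : Echo x x' → Copy (u ++ f ++ v) s p m ⊎ Mirror (u ++ f ++ v) s p m
  trace-echo (inj₁ refl) = inj₁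
    ( trans (in-x 0 z≤n (sym (ℕ.+-identityʳ s))) (sym (in-x' 0 z≤n (sym (ℕ.+-identityʳ (s + p)))))
    , λ 0<m → trans (in-x 1 0<m (ℕ.+-comm 1 s)) (sym (in-x' 1 0<m (ℕ.+-comm 1 (s + p)))) )
  trace-echo (inj₂ refl) = inj₂
    ( trans (in-x 0 z≤n (sym (ℕ.+-identityʳ s))) (sym (trans (in-x' m ℕ.≤-refl refl) (reverse-!-last a x₀)))
    , trans (in-x m ℕ.≤-refl refl) (sym (trans (in-x' 0 z≤n (sym (ℕ.+-identityʳ (s + p)))) (reverse-!-head a x₀))) )

¬trace⇒free : ∀ c {k} (w : List (Fin (suc k))) → ¬ PowerTrace (suc c) w → UFree (threshold (3 + c)) w
¬trace⇒free c w no-trace _ factor _ t≤r power = no-trace (upower⇒trace c factor t≤r power)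

powerTraceAt? : ∀ {k} n (w : List (Fin (suc k))) s m q → Dec (PowerTraceAt n w s m q)
powerTraceAt? n w s m q =
  map′ (λ (f , sh , e) → powerTraceAt f sh e) (λ t → fits t , short t , echo t)
    (_ ≤ℕ? _ ×-dec _ ≤ℕ? _ ×-dec
      ((w ! s Fin.≟ w ! (s + p) ×-dec (0 <ℕ? m →-dec w ! suc s Fin.≟ w ! (suc s + p)))
       ⊎-dec (w ! s Fin.≟ w ! (s + p + m) ×-dec w ! (s + m) Fin.≟ w ! (s + p))))
  where
  open PowerTraceAt using (fits; short; echo)
  p = suc (m + q)

powerTrace? : ∀ {k} n (w : List (Fin (suc k))) → Dec (PowerTrace n w)
powerTrace? n w = map′
  (λ (s , _ , m , _ , q , _ , t) → s , m , q , t)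
  (λ (s , m , q , t) → let fits = PowerTraceAt.fits t in
     s , ℕ.<-≤-trans (ℕ.<-≤-trans (ℕ.m<m+n s (s≤s z≤n)) (ℕ.m≤m+n _ _)) fits ,
     m , ℕ.≤-trans (ℕ.m≤n+m (suc m) _) fits ,
     q , ℕ.≤-trans (s≤s (ℕ.m≤n+m q m)) (ℕ.≤-trans (ℕ.m≤n+m _ s) (ℕ.≤-trans (ℕ.m≤m+n _ (suc m)) fits)) ,
     t)
  (anyUpTo? (λ s → anyUpTo? (λ m → anyUpTo? (λ q → powerTraceAt? n w s m q) L) L) L)
  where L = length w

toℕ-mod : ∀ {v K} .{{_ : ℕ.NonZero K}} → v <ℕ K → toℕ (v mod K) ≡ v
toℕ-mod v<K = trans (Fin.toℕ-fromℕ< _) (m<n⇒m%n≡m v<K)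

module _ (e : ℕ) where
  private
    n K : ℕ
    n = 3 + e
    K = 2 + n

  tail-value : Fin 4 → ℕ
  tail-value 0F = 0
  tail-value 1F = suc n
  tail-value 2F = 1
  tail-value 3F = 3

  -- A left inverse of tail-value: its four values 0, n + 1, 1, 3 are distinct since n ≥ 3.
  tail-offset : ℕ → Fin 4
  tail-offset 0 = 0F
  tail-offset 1 = 2F
  tail-offset 3 = 3F
  tail-offset _ = 1F

  tail-offset-value : ∀ t → tail-offset (tail-value t) ≡ t
  tail-offset-value 0F = refl
  tail-offset-value 1F = refl
  tail-offset-value 2F = refl
  tail-offset-value 3F = refl

  tail-value-injective : ∀ {t t'} → tail-value t ≡ tail-value t' → t ≡ t'
  tail-value-injective {t} {t'} eq =
    trans (sym (tail-offset-value t)) (trans (cong tail-offset eq) (tail-offset-value t'))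

  ladder tail witness : List (Fin K)
  ladder = applyUpTo (_mod K) (suc n)
  tail   = 0 mod K ∷ suc n mod K ∷ 1 mod K ∷ 3 mod K ∷ []
  witness   = ladder ++ tail

  tail-! : ∀ t → tail ! toℕ t ≡ tail-value t mod K
  tail-! 0F = refl
  tail-! 1F = refl
  tail-! 2F = refl
  tail-! 3F = refl

  length-witness : length witness ≡ K + 3
  length-witness = trans (length-++ ladder) (trans (cong (_+ 4) (length-applyUpTo (_mod K) (suc n))) (cong suc (ℕ.+-suc n 3)))

  data Place : ℕ → Set where
    in-ladder : ∀ {i} → i ≤ℕ n → Place i
    in-tail   : (t : Fin 4) → Place (toℕ t + suc n)

  place : ∀ i → i <ℕ K + 3 → Place i
  place i i<K+3 with i ≤ℕ? n
  ... | yes i≤n = in-ladder i≤n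
  ... | no  i≰n with o , refl ← ℕ.m≤n⇒∃[o]m+o≡n (ℕ.≰⇒> i≰n) =
    subst Place (trans (cong (_+ suc n) (Fin.toℕ-fromℕ< o<4)) (ℕ.+-comm o (suc n))) (in-tail (fromℕ< o<4))
    where
    o<4 : o <ℕ 4
    o<4 = ℕ.+-cancelˡ-< (suc n) o 4 (subst (suc n + o <ℕ_) (cong suc (sym (ℕ.+-suc n 3))) i<K+3)

  value : ∀ {i} → Place i → ℕ
  value {i} (in-ladder _) = i
  value (in-tail t)       = tail-value t

  value<K : ∀ {i} (pl : Place i) → value pl <ℕ K
  value<K (in-ladder i≤n) = s≤s (ℕ.m≤n⇒m≤1+n i≤n)
  value<K (in-tail 0F)    = s≤s z≤n
  value<K (in-tail 1F)    = ℕ.≤-refl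
  value<K (in-tail 2F)    = s≤s (s≤s z≤n)
  value<K (in-tail 3F)    = s≤s (s≤s (s≤s (s≤s z≤n)))

  witness-value : ∀ {i} (pl : Place i) → toℕ (witness ! i) ≡ value pl
  witness-value pl = trans (cong toℕ (letter pl)) (toℕ-mod (value<K pl))
    where
    length-ladder : length ladder ≡ suc n
    length-ladder = length-applyUpTo (_mod K) (suc n)
    letter : ∀ {i} (pl : Place i) → witness ! i ≡ value pl mod K
    letter (in-ladder {i} i≤n) =
      trans (!-++ˡ ladder tail (subst (i <ℕ_) (sym length-ladder) (s≤s i≤n))) (!-applyUpTo (_mod K) (s≤s i≤n))
    letter (in-tail t) = begin
      witness ! (toℕ t + suc n)         ≡⟨ cong (witness !_) (trans (ℕ.+-comm (toℕ t) (suc n))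
                                                                   (cong (_+ toℕ t) (sym length-ladder))) ⟩
      witness ! (length ladder + toℕ t) ≡⟨ !-++ʳ ladder (toℕ t) ⟩
      tail ! toℕ t                   ≡⟨ tail-! t ⟩
      tail-value t mod K             ∎
      where open ≡-Reasoning

  data Repeat : ℕ → ℕ → Set where
    repeat₀ : Repeat 0 (suc n)
    repeat₁ : Repeat 1 (3 + n)
    repeat₃ : Repeat 3 (4 + n)

  classify : ∀ {i j} (pi : Place i) (pj : Place j) → i <ℕ j → value pi ≡ value pj → Repeat i j
  classify (in-ladder _)   (in-ladder _) i<j refl = ⊥-elim (ℕ.<-irrefl refl i<j)
  classify (in-ladder _)   (in-tail 0F)  _   refl = repeat₀
  classify (in-ladder i≤n) (in-tail 1F)  _   refl = ⊥-elim (ℕ.<-irrefl refl i≤n)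
  classify (in-ladder _)   (in-tail 2F)  _   refl = repeat₁
  classify (in-ladder _)   (in-tail 3F)  _   refl = repeat₃
  classify (in-tail t) (in-ladder j≤n) i<j _ =
    ⊥-elim (ℕ.<⇒≱ (ℕ.<-≤-trans i<j j≤n) (ℕ.≤-trans (ℕ.n≤1+n n) (ℕ.m≤n+m (suc n) (toℕ t))))
  classify (in-tail t) (in-tail t') i<j eq =
    ⊥-elim (ℕ.<-irrefl (cong (λ t → toℕ t + suc n) (tail-value-injective eq)) i<j)

  equal⇒repeat : ∀ {i j} → i <ℕ j → j <ℕ K + 3 → witness ! i ≡ witness ! j → Repeat i j
  equal⇒repeat {i} {j} i<j j< eq =
    classify pi pj i<j (trans (sym (witness-value pi)) (trans (cong toℕ eq) (witness-value pj)))
    where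
    pi = place i (ℕ.<-trans i<j j<)
    pj = place j j<

  repeat-gap : ∀ {i j} → Repeat i j → i + n <ℕ j
  repeat-gap repeat₀ = ℕ.≤-refl
  repeat-gap repeat₁ = ℕ.n≤1+n _
  repeat-gap repeat₃ = ℕ.≤-refl

  repeat-not-consecutive : ∀ {i j} → Repeat i j → ¬ Repeat (suc i) (suc j)
  repeat-not-consecutive repeat₀ ()
  repeat-not-consecutive repeat₁ ()
  repeat-not-consecutive repeat₃ ()

  repeat-sum-injective : ∀ {i j i' j'} → Repeat i j → Repeat i' j' → i + j ≡ i' + j' → i ≡ i'
  repeat-sum-injective repeat₀ repeat₀ _  = refl
  repeat-sum-injective repeat₀ repeat₁ ()
  repeat-sum-injective repeat₀ repeat₃ ()
  repeat-sum-injective repeat₁ repeat₀ ()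
  repeat-sum-injective repeat₁ repeat₁ _  = refl
  repeat-sum-injective repeat₁ repeat₃ ()
  repeat-sum-injective repeat₃ repeat₀ ()
  repeat-sum-injective repeat₃ repeat₁ ()
  repeat-sum-injective repeat₃ repeat₃ _  = refl

  private
    in-witness : ∀ {L j} → L ≤ℕ length witness → j <ℕ L → j <ℕ K + 3
    in-witness {j = j} L≤ j<L = subst (j <ℕ_) length-witness (ℕ.<-≤-trans j<L L≤)

    s<s+p : ∀ s q → s <ℕ s + suc q
    s<s+p s q = ℕ.m<m+n s (s≤s z≤n)

    close-repeat : ∀ {s p} → s + suc p + 1 ≤ℕ length witness → suc p ≤ℕ 1 * n →
      witness ! s ≡ witness ! (s + suc p) → ⊥
    close-repeat {s} {p} fits short e =
      ℕ.<⇒≱ (ℕ.+-cancelˡ-< s n _ (repeat-gap r)) (subst (suc p ≤ℕ_) (ℕ.*-identityˡ n) short)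
      where
      r : Repeat s (s + suc p)
      r = equal⇒repeat (s<s+p s p) (in-witness fits (ℕ.m<m+n _ (s≤s z≤n))) e

  no-trace : ¬ PowerTrace n witness
  no-trace (s , zero , q , powerTraceAt fits short (inj₁ (e₀ , _))) = close-repeat fits short e₀
  no-trace (s , zero , q , powerTraceAt fits short (inj₂ (e₀ , _))) =
    close-repeat fits short (trans e₀ (cong (witness !_) (ℕ.+-identityʳ (s + suc q))))
  no-trace (s , suc m , q , powerTraceAt fits _ (inj₁ (e₀ , e₁))) =
    repeat-not-consecutive (equal⇒repeat (s<s+p s (suc m + q)) (in-witness fits (ℕ.m<m+n _ (s≤s z≤n))) e₀)
      (equal⇒repeat (s≤s (s<s+p s (suc m + q))) (in-witness fits two-more) (e₁ (s≤s z≤n)))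
    where
    P = s + suc (suc m + q)
    two-more : suc P <ℕ P + suc (suc m)
    two-more = subst (_≤ℕ P + suc (suc m)) (ℕ.+-comm P 2) (ℕ.+-monoʳ-≤ P (s≤s (s≤s z≤n)))
  no-trace (s , suc m , q , powerTraceAt fits _ (inj₂ (e₀ , e₁))) =
    ℕ.m≢1+m+n s (trans (repeat-sum-injective outer inner same-sum) (ℕ.+-suc s m))
    where
    P = s + suc (suc m + q)
    outer : Repeat s (P + suc m)
    outer = equal⇒repeat (ℕ.<-≤-trans (s<s+p s (suc m + q)) (ℕ.m≤m+n P (suc m)))
      (in-witness fits (ℕ.+-monoʳ-< P ℕ.≤-refl)) e₀
    inner : Repeat (s + suc m) P
    inner = equal⇒repeat (ℕ.+-monoʳ-< s (s≤s (s≤s (ℕ.m≤m+n m q))))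
      (in-witness fits (ℕ.m<m+n P (s≤s z≤n))) e₁
    same-sum : s + (P + suc m) ≡ s + suc m + P
    same-sum = solve 3 (λ s m q → s :+ ((s :+ (con 2 :+ m :+ q)) :+ (con 1 :+ m))
                               := (s :+ (con 1 :+ m)) :+ (s :+ (con 2 :+ m :+ q))) refl s m q
      where open +-*-Solver

  witness-free : UFree (threshold (5 + e)) witness
  witness-free = ¬trace⇒free (2 + e) witness no-trace

witness₄ : List (Fin 4)
witness₄ = 0F ∷ 1F ∷ 2F ∷ 0F ∷ 3F ∷ 1F ∷ 0F ∷ []

witness₄-free : UFree (threshold 4) witness₄
witness₄-free = ¬trace⇒free 1 witness₄ (from-no (powerTrace? 2 witness₄))

¬NoShortPowers : ∀ d (w : List (Fin (4 + d))) → length w ≡ (4 + d) + 4 → ¬ NoShortPowers (2 + d) w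
¬NoShortPowers 0             = ¬NoShortPowers-n=2
¬NoShortPowers 1             = ¬NoShortPowers-n=3
¬NoShortPowers (suc (suc d)) = ¬NoShortPowers-4≤n (4 + d) (s≤s (s≤s (s≤s (s≤s z≤n))))

no-long-free-word : ∀ d (w : List (Fin (4 + d))) → length w ≡ (4 + d) + 4 → ¬ UFree (threshold (4 + d)) w
no-long-free-word d w len free = ¬NoShortPowers d w len (free⇒noShortPowers (suc d) w free)

long-free-word : ∀ d → ∃ λ (w : List (Fin (4 + d))) → length w ≡ (4 + d) + 3 × UFree (threshold (4 + d)) w
long-free-word 0       = witness₄ , refl , witness₄-free
long-free-word (suc e) = witness e , length-witness e , witness-free e

avoidable⇒threshold≤ : ∀ d r → UAvoidable (Fin (4 + d)) r → threshold (4 + d) ≤ r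
avoidable⇒threshold≤ d r (s , free) with threshold (4 + d) ℚ.≤? r
... | yes t≤r = t≤r
... | no  t≰r = ⊥-elim (no-long-free-word d (prefix s L) (length-applyUpTo s L)
                  (UFree-mono (ℚ.<⇒≤ (ℚ.≰⇒> t≰r)) (free L)))
  where L = (4 + d) + 4

theorem5 : (k : ℕ) → 4 ≤ℕ k →
    ((r : ℚ) → 1ℚ < r → r ≤ (+ 2) / 1 → UAvoidable (Fin k) r → threshold k ≤ r)
    × (∃ λ (w : List (Fin k)) → length w ≡ k + 3 × UFree (threshold k) w)
    × ((w : List (Fin k)) → length w ≡ k + 4 → ¬ UFree (threshold k) w)
theorem5 (suc (suc (suc (suc d)))) (s≤s (s≤s (s≤s (s≤s z≤n)))) =
  (λ r _ _ → avoidable⇒threshold≤ d r) , long-free-word d , no-long-free-word d
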